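{- For every lattice path matroid $M=M[U,L]$ that is a block matroid, there is a lattice path matroid $N$ on the same ground set which is a block matroid and whose set of bases equals the set of base-cobases of $M$; in particular $G(M,M^\ast)=G(N)$.
   Context: For nonnegative integers $m,r$, $n=m+r$, let $U,L$ be lattice paths from $(0,0)$ to $(m,r)$ with unit east and north steps, $L$ never above $U$. The lattice path matroid $M[U,L]$ is the matroid on $[n]$ whose bases are the sets $B\subseteq[n]$ such that the lattice path whose $i$-th step is north iff $i\in B$ stays weakly below $U$ and weakly above $L$. For a matroid $M$ on $E$, a base-cobase is a base $B$ with $E\setminus B$ also a base; $M$ is a block matroid if it has one. $G(\cdot)$ denotes the base graph (bases as vertices, adjacent iff symmetric difference has size 2) and $G(M,M^\ast)$ its subgraph induced by base-cobases. -}

module Defs where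

open import Data.Nat using (ℕ; zero; suc; _≤_)
open import Data.Bool using (Bool; true; false)
open import Data.Vec using (Vec; []; _∷_)
open import Data.Fin.Subset using (Subset; ∁; ∣_∣)
open import Data.Product using (Σ; _×_; ∃)
open import Relation.Binary.PropositionalEquality using (_≡_)

-- A word of length n over {east = false, north = true} encodes a lattice
-- path with n unit steps; equivalently, a subset of [n] = Fin n (the set of
-- positions of north steps).

north : ∀ {n} → ℕ → Vec Bool n → ℕ
north zero    _            = 0
north (suc k) []           = 0
north (suc k) (true  ∷ p)  = suc (north k p)
north (suc k) (false ∷ p)  = north k p

_Below_ : ∀ {n} → Vec Bool n → Vec Bool n → Set
P Below Q = ∀ k → north k P ≤ north k Q

-- Lattice path matroid data on ground set [n], with n = m + r:
-- U and L are lattice paths from (0,0) to (m,r) (r north steps, m = n - r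
-- east steps) and L never goes above U.
record LPMData (n : ℕ) : Set where
  field
    r     : ℕ
    U     : Subset n
    L     : Subset n
    U-end : ∣ U ∣ ≡ r
    L-end : ∣ L ∣ ≡ r
    L≤U   : L Below U

open LPMData public

IsBase : ∀ {n} → LPMData n → Subset n → Set
IsBase M B = (∣ B ∣ ≡ r M) × (B Below U M) × (L M Below B)

IsBaseCobase : ∀ {n} → LPMData n → Subset n → Set
IsBaseCobase M B = IsBase M B × IsBase M (∁ B)

IsBlock : ∀ {n} → LPMData n → Set
IsBlock M = ∃ λ B → IsBaseCobase M B

-- Complementing a subset reverses the order of lattice paths: B lies below Y
-- iff ∁ Y lies below ∁ B.  Hence B and ∁ B are both bases of M[U,L] exactly
-- when B lies between L ⊔ ∁ U and U ⊓ ∁ L, where ⊔ and ⊓ are taken pointwise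
-- on the north-step counts.  Pointwise max and min of lattice paths are again
-- lattice paths, so the base-cobases are the bases of the lattice path
-- matroid M[U ⊓ ∁ L, L ⊔ ∁ U]; it is a block matroid because with B₀ it also
-- contains ∁ B₀.
module Submission where

open import Defs
open import Data.Nat using (ℕ; zero; suc; _+_; _∸_; _≤_; _⊓_; _⊔_; _<ᵇ_; z≤n; s≤s)
open import Data.Nat.Properties
open import Data.Bool using (Bool; true; false; not)
open import Data.Bool.Properties using (not-involutive)
open import Data.Vec using (Vec; []; _∷_)
open import Data.Vec.Properties using (map-∘; map-cong; map-id)
open import Data.Fin.Subset using (Subset; ∁; ∣_∣)
open import Data.Fin.Subset.Properties using (∣∁p∣≡n∸∣p∣)
open import Data.Product using (Σ; _×_; _,_)
open import Function.Bundles using (_⇔_; mk⇔; Equivalence)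
open import Relation.Binary.PropositionalEquality

open Equivalence using (to; from)

north-mono : ∀ {n} k (P : Vec Bool n) → north k P ≤ north (suc k) P
north-mono zero    P           = z≤n
north-mono (suc k) []          = z≤n
north-mono (suc k) (true ∷ P)  = s≤s (north-mono k P)
north-mono (suc k) (false ∷ P) = north-mono k P

north-suc-≤ : ∀ {n} k (P : Vec Bool n) → north (suc k) P ≤ suc (north k P)
north-suc-≤ zero    []          = z≤n
north-suc-≤ zero    (true ∷ P)  = ≤-refl
north-suc-≤ zero    (false ∷ P) = z≤n
north-suc-≤ (suc k) []          = z≤n
north-suc-≤ (suc k) (true ∷ P)  = s≤s (north-suc-≤ k P)
north-suc-≤ (suc k) (false ∷ P) = north-suc-≤ k P

north-stable : ∀ {n} k (P : Vec Bool n) → n ≤ k → north (suc k) P ≡ north k P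
north-stable zero    []          _         = refl
north-stable (suc k) []          _         = refl
north-stable (suc k) (true ∷ P)  (s≤s n≤k) = cong suc (north-stable k P n≤k)
north-stable (suc k) (false ∷ P) (s≤s n≤k) = north-stable k P n≤k

∣∣≡north : ∀ {n} (X : Subset n) → ∣ X ∣ ≡ north n X
∣∣≡north []          = refl
∣∣≡north (true ∷ X)  = cong suc (∣∣≡north X)
∣∣≡north (false ∷ X) = ∣∣≡north X

north-∁ : ∀ {n} k (X : Subset n) → north k (∁ X) + north k X ≡ k ⊓ n
north-∁ zero    X           = refl
north-∁ (suc k) []          = refl
north-∁ (suc k) (true ∷ X)  = trans (+-suc _ _) (cong suc (north-∁ k X))
north-∁ (suc k) (false ∷ X) = cong suc (north-∁ k X)

∁-involutive : ∀ {n} (X : Subset n) → ∁ (∁ X) ≡ X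
∁-involutive X = trans (sym (map-∘ not not X)) (trans (map-cong not-involutive X) (map-id X))

∁-Below : ∀ {n} {X Y : Subset n} → X Below Y → ∁ Y Below ∁ X
∁-Below {n} {X} {Y} X≤Y k = +-cancelʳ-≤ (north k Y) _ _ (begin
  north k (∁ Y) + north k Y ≡⟨ north-∁ k Y ⟩
  k ⊓ n                     ≡⟨ north-∁ k X ⟨
  north k (∁ X) + north k X ≤⟨ +-monoʳ-≤ (north k (∁ X)) (X≤Y k) ⟩
  north k (∁ X) + north k Y ∎)
  where open ≤-Reasoning

∁-Belowˡ : ∀ {n} {X Y : Subset n} → ∁ X Below Y → ∁ Y Below X
∁-Belowˡ {X = X} ∁X≤Y = subst (λ Z → _ Below Z) (∁-involutive X) (∁-Below ∁X≤Y)

∁-Belowʳ : ∀ {n} {X Y : Subset n} → X Below ∁ Y → Y Below ∁ X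
∁-Belowʳ {Y = Y} X≤∁Y = subst (λ Z → Z Below _) (∁-involutive Y) (∁-Below X≤∁Y)

-- The prefix counts k ↦ north k P of paths P of length n; unlike paths,
-- these are visibly closed under pointwise ⊓ and ⊔.
record IsPathProfile (n : ℕ) (f : ℕ → ℕ) : Set where
  field
    start  : f 0 ≡ 0
    mono   : ∀ k → f k ≤ f (suc k)
    unit   : ∀ k → f (suc k) ≤ suc (f k)
    stable : ∀ k → n ≤ k → f (suc k) ≡ f k

open IsPathProfile

north-isPathProfile : ∀ {n} (P : Vec Bool n) → IsPathProfile n (λ k → north k P)
north-isPathProfile P = record
  { start  = refl
  ; mono   = λ k → north-mono k P
  ; unit   = λ k → north-suc-≤ k P
  ; stable = λ k → north-stable k P
  }

⊓-isPathProfile : ∀ {n f g} → IsPathProfile n f → IsPathProfile n g →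
                  IsPathProfile n (λ k → f k ⊓ g k)
⊓-isPathProfile p q = record
  { start  = cong₂ _⊓_ (start p) (start q)
  ; mono   = λ k → ⊓-mono-≤ (mono p k) (mono q k)
  ; unit   = λ k → ⊓-mono-≤ (unit p k) (unit q k)
  ; stable = λ k n≤k → cong₂ _⊓_ (stable p k n≤k) (stable q k n≤k)
  }

⊔-isPathProfile : ∀ {n f g} → IsPathProfile n f → IsPathProfile n g →
                  IsPathProfile n (λ k → f k ⊔ g k)
⊔-isPathProfile p q = record
  { start  = cong₂ _⊔_ (start p) (start q)
  ; mono   = λ k → ⊔-mono-≤ (mono p k) (mono q k)
  ; unit   = λ k → ⊔-mono-≤ (unit p k) (unit q k)
  ; stable = λ k n≤k → cong₂ _⊔_ (stable p k n≤k) (stable q k n≤k)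
  }

realise : (n : ℕ) → (ℕ → ℕ) → Vec Bool n
realise zero    f = []
realise (suc n) f = (0 <ᵇ f 1) ∷ realise n (λ k → f (suc k) ∸ f 1)

module _ {n f} (p : IsPathProfile n f) where

  first-≤-1 : f 1 ≤ 1
  first-≤-1 = subst (λ a → f 1 ≤ suc a) (start p) (unit p 0)

  first-≤ : ∀ k → f 1 ≤ f (suc k)
  first-≤ zero    = ≤-refl
  first-≤ (suc k) = ≤-trans (first-≤ k) (mono p (suc k))

tail-isPathProfile : ∀ {n f} → IsPathProfile (suc n) f →
                     IsPathProfile n (λ k → f (suc k) ∸ f 1)
tail-isPathProfile {f = f} p = record
  { start  = n∸n≡0 (f 1)
  ; mono   = λ k → ∸-monoˡ-≤ (f 1) (mono p (suc k))
  ; unit   = λ k → ≤-trans (∸-monoˡ-≤ (f 1) (unit p (suc k)))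
                           (≤-reflexive (+-∸-assoc 1 (first-≤ p k)))
  ; stable = λ k n≤k → cong (_∸ f 1) (stable p (suc k) (s≤s n≤k))
  }

isPathProfile-zero : ∀ {f} → IsPathProfile 0 f → ∀ k → f k ≡ 0
isPathProfile-zero p zero    = start p
isPathProfile-zero p (suc k) = trans (stable p k z≤n) (isPathProfile-zero p k)

north-∷ : ∀ {n} x y k (P : Vec Bool n) → x ≤ 1 → x ≤ y → north k P ≡ y ∸ x →
          north (suc k) ((0 <ᵇ x) ∷ P) ≡ y
north-∷ zero          y       k P _        _ e = e
north-∷ (suc zero)    (suc y) k P _        _ e = cong suc e
north-∷ (suc (suc x)) y       k P (s≤s ()) _ _

north-realise : ∀ {n f} → IsPathProfile n f → ∀ k → north k (realise n f) ≡ f k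
north-realise                 p zero    = sym (start p)
north-realise {zero}          p (suc k) = sym (isPathProfile-zero p (suc k))
north-realise {suc n} {f = f} p (suc k) =
  north-∷ (f 1) (f (suc k)) k _ (first-≤-1 p) (first-≤ p k)
    (north-realise (tail-isPathProfile p) k)

_⊓ᴾ_ : ∀ {n} → Vec Bool n → Vec Bool n → Vec Bool n
_⊓ᴾ_ {n} P Q = realise n (λ k → north k P ⊓ north k Q)

_⊔ᴾ_ : ∀ {n} → Vec Bool n → Vec Bool n → Vec Bool n
_⊔ᴾ_ {n} P Q = realise n (λ k → north k P ⊔ north k Q)

north-⊓ᴾ : ∀ {n} (P Q : Vec Bool n) k → north k (P ⊓ᴾ Q) ≡ north k P ⊓ north k Q
north-⊓ᴾ P Q = north-realise (⊓-isPathProfile (north-isPathProfile P) (north-isPathProfile Q))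

north-⊔ᴾ : ∀ {n} (P Q : Vec Bool n) k → north k (P ⊔ᴾ Q) ≡ north k P ⊔ north k Q
north-⊔ᴾ P Q = north-realise (⊔-isPathProfile (north-isPathProfile P) (north-isPathProfile Q))

∣⊓ᴾ∣≡ : ∀ {n a} (X Y : Subset n) → ∣ X ∣ ≡ a → ∣ Y ∣ ≡ a → ∣ X ⊓ᴾ Y ∣ ≡ a
∣⊓ᴾ∣≡ {n} {a} X Y ∣X∣≡a ∣Y∣≡a = begin
  ∣ X ⊓ᴾ Y ∣            ≡⟨ ∣∣≡north (X ⊓ᴾ Y) ⟩
  north n (X ⊓ᴾ Y)      ≡⟨ north-⊓ᴾ X Y n ⟩
  north n X ⊓ north n Y ≡⟨ cong₂ _⊓_ (∣∣≡north X) (∣∣≡north Y) ⟨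
  ∣ X ∣ ⊓ ∣ Y ∣         ≡⟨ cong₂ _⊓_ ∣X∣≡a ∣Y∣≡a ⟩
  a ⊓ a                 ≡⟨ ⊓-idem a ⟩
  a                     ∎
  where open ≡-Reasoning

∣⊔ᴾ∣≡ : ∀ {n a} (X Y : Subset n) → ∣ X ∣ ≡ a → ∣ Y ∣ ≡ a → ∣ X ⊔ᴾ Y ∣ ≡ a
∣⊔ᴾ∣≡ {n} {a} X Y ∣X∣≡a ∣Y∣≡a = begin
  ∣ X ⊔ᴾ Y ∣            ≡⟨ ∣∣≡north (X ⊔ᴾ Y) ⟩
  north n (X ⊔ᴾ Y)      ≡⟨ north-⊔ᴾ X Y n ⟩
  north n X ⊔ north n Y ≡⟨ cong₂ _⊔_ (∣∣≡north X) (∣∣≡north Y) ⟨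
  ∣ X ∣ ⊔ ∣ Y ∣         ≡⟨ cong₂ _⊔_ ∣X∣≡a ∣Y∣≡a ⟩
  a ⊔ a                 ≡⟨ ⊔-idem a ⟩
  a                     ∎
  where open ≡-Reasoning

Below-⊓ᴾ : ∀ {n} {B P Q : Vec Bool n} → B Below (P ⊓ᴾ Q) ⇔ (B Below P × B Below Q)
Below-⊓ᴾ {B = B} {P} {Q} = mk⇔
  (λ B≤P⊓Q → (λ k → ≤-trans (le k B≤P⊓Q) (m⊓n≤m _ _)) , (λ k → ≤-trans (le k B≤P⊓Q) (m⊓n≤n _ _)))
  (λ (B≤P , B≤Q) k → ≤-trans (⊓-glb (B≤P k) (B≤Q k)) (≤-reflexive (sym (north-⊓ᴾ P Q k))))
  where
  le : ∀ k → B Below (P ⊓ᴾ Q) → north k B ≤ north k P ⊓ north k Q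
  le k B≤P⊓Q = ≤-trans (B≤P⊓Q k) (≤-reflexive (north-⊓ᴾ P Q k))

⊔ᴾ-Below : ∀ {n} {B P Q : Vec Bool n} → (P ⊔ᴾ Q) Below B ⇔ (P Below B × Q Below B)
⊔ᴾ-Below {B = B} {P} {Q} = mk⇔
  (λ P⊔Q≤B → (λ k → ≤-trans (m≤m⊔n _ _) (le k P⊔Q≤B)) , (λ k → ≤-trans (m≤n⊔m _ _) (le k P⊔Q≤B)))
  (λ (P≤B , Q≤B) k → ≤-trans (≤-reflexive (north-⊔ᴾ P Q k)) (⊔-lub (P≤B k) (Q≤B k)))
  where
  le : ∀ k → (P ⊔ᴾ Q) Below B → north k P ⊔ north k Q ≤ north k B
  le k P⊔Q≤B = ≤-trans (≤-reflexive (sym (north-⊔ᴾ P Q k))) (P⊔Q≤B k)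

∁-IsBaseCobase : ∀ {n} (M : LPMData n) {B} → IsBaseCobase M B → IsBaseCobase M (∁ B)
∁-IsBaseCobase M {B} (base , cobase) = cobase , subst (IsBase M) (sym (∁-involutive B)) base

block⇒∸r≡r : ∀ {n} (M : LPMData n) → IsBlock M → n ∸ r M ≡ r M
block⇒∸r≡r {n} M (B , (∣B∣≡r , _) , (∣∁B∣≡r , _)) =
  trans (cong (n ∸_) (sym ∣B∣≡r)) (trans (sym (∣∁p∣≡n∸∣p∣ B)) ∣∁B∣≡r)

module _ {n} (M : LPMData n) (block : IsBlock M) where

  upper lower : Subset n
  upper = U M ⊓ᴾ ∁ (L M)
  lower = L M ⊔ᴾ ∁ (U M)

  ∣∁∣≡r : ∀ (X : Subset n) → ∣ X ∣ ≡ r M → ∣ ∁ X ∣ ≡ r M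
  ∣∁∣≡r X ∣X∣≡r = trans (∣∁p∣≡n∸∣p∣ X) (trans (cong (n ∸_) ∣X∣≡r) (block⇒∸r≡r M block))

  IsBaseCobase⇔between : ∀ B → IsBaseCobase M B ⇔ (∣ B ∣ ≡ r M × B Below upper × lower Below B)
  IsBaseCobase⇔between B = mk⇔
    (λ ((∣B∣≡r , B≤U , L≤B) , (_ , ∁B≤U , L≤∁B)) →
      ∣B∣≡r , from Below-⊓ᴾ (B≤U , ∁-Belowʳ L≤∁B) , from ⊔ᴾ-Below (L≤B , ∁-Belowˡ ∁B≤U))
    (λ (∣B∣≡r , B≤upper , lower≤B) →
      let (B≤U , B≤∁L) = to Below-⊓ᴾ B≤upper
          (L≤B , ∁U≤B) = to ⊔ᴾ-Below lower≤B
      in (∣B∣≡r , B≤U , L≤B) , (∣∁∣≡r B ∣B∣≡r , ∁-Belowˡ ∁U≤B , ∁-Belowʳ B≤∁L))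

  baseCobaseMatroid : LPMData n
  baseCobaseMatroid = record
    { r     = r M
    ; U     = upper
    ; L     = lower
    ; U-end = ∣⊓ᴾ∣≡ (U M) (∁ (L M)) (U-end M) (∣∁∣≡r (L M) (L-end M))
    ; L-end = ∣⊔ᴾ∣≡ (L M) (∁ (U M)) (L-end M) (∣∁∣≡r (U M) (U-end M))
    ; L≤U   = let (B₀ , bc₀) = block
                  (_ , B₀≤upper , lower≤B₀) = to (IsBaseCobase⇔between B₀) bc₀
              in λ k → ≤-trans (lower≤B₀ k) (B₀≤upper k)
    }

  IsBase-baseCobaseMatroid : ∀ B → IsBase baseCobaseMatroid B ⇔ IsBaseCobase M B
  IsBase-baseCobaseMatroid B = mk⇔ (from (IsBaseCobase⇔between B)) (to (IsBaseCobase⇔between B))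

  baseCobaseMatroid-isBlock : IsBlock baseCobaseMatroid
  baseCobaseMatroid-isBlock =
    let (B₀ , bc₀) = block
    in B₀ , from (IsBase-baseCobaseMatroid B₀) bc₀
          , from (IsBase-baseCobaseMatroid (∁ B₀)) (∁-IsBaseCobase M bc₀)

proposition3p5 : ∀ (n : ℕ) (M : LPMData n) → IsBlock M →
    Σ (LPMData n) λ N → IsBlock N × (∀ (B : Subset n) → IsBase N B ⇔ IsBaseCobase M B)
proposition3p5 n M block =
  baseCobaseMatroid M block , baseCobaseMatroid-isBlock M block , IsBase-baseCobaseMatroid M block
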